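{- Let $q\ge 2$ be an integer and let $G$ be a graph with minimum degree at least $4q^2$. Then $G$ contains a $q$-connected induced subgraph $H$ with more than $4q^2$ vertices such that \[\bigl|\{v\in V(H): N_G(v)\setminus V(H)\neq\emptyset\}\bigr|\le 2q^2.\]
   Context: All graphs are finite and simple. $N_G(v)$ denotes the neighborhood of $v$ in $G$. -}

module Defs where

open import Data.Nat using (ℕ; _<_; _≤_)
open import Data.Bool using (Bool; true; false; _∧_; not)
open import Data.Fin using (Fin)
open import Data.Fin.Subset using (Subset; _∈_; _∉_; _⊆_; _─_; ∣_∣)
open import Data.Vec using (tabulate; lookup)
open import Data.List.Base using (allFin)
open import Data.Bool.ListAction using (any)
open import Data.Product using (_×_)
open import Relation.Binary.PropositionalEquality using (_≡_)

record Graph (n : ℕ) : Set where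
  field
    adj   : Fin n → Fin n → Bool
    sym   : ∀ u v → adj u v ≡ adj v u
    irrefl : ∀ v → adj v v ≡ false

open Graph public

module _ {n : ℕ} (G : Graph n) where

  N : Fin n → Subset n
  N v = tabulate (adj G v)

  degree : Fin n → ℕ
  degree v = ∣ N v ∣

  MinDegree≥ : ℕ → Set
  MinDegree≥ d = ∀ v → d ≤ degree v

  data Reach (U : Subset n) (u : Fin n) : Fin n → Set where
    here : u ∈ U → Reach U u u
    step : ∀ {w v} → Reach U u w → adj G w v ≡ true → v ∈ U → Reach U u v

  Connected : Subset n → Set
  Connected U = ∀ u v → u ∈ U → v ∈ U → Reach U u v

  KConnected : ℕ → Subset n → Set
  KConnected k S = k < ∣ S ∣ × (∀ (X : Subset n) → X ⊆ S → ∣ X ∣ < k → Connected (S ─ X))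

  boundary : Subset n → Subset n
  boundary S = tabulate (λ v → lookup S v ∧ any (λ w → adj G v w ∧ not (lookup S w)) (allFin n))

-- Call S ⊆ V(G) a candidate if some vertex of S has all its neighbours in S (so |S| > 4q²)
-- and the cost Σ_{v ∈ S} min(q, |N(v) ∖ S|) of S is at most 2q²; the cost bounds the
-- boundary of S, and V(G) itself is a candidate of cost 0. If a candidate S is not
-- q-connected, some X ⊆ S with |X| < q splits S ∖ X into sides A and B with no edges
-- between them, and deleting one side gives a smaller candidate. If both sides contain
-- interior vertices, keep the side of smaller cost: it costs at most q², and X adds at most
-- |X|·q. If only A does, every vertex of B has a neighbour outside S, so |B| ≤ 2q²; then
-- each b ∈ B has at least 4q² − (2q² + q) ≥ q neighbours outside S and costs q, so deleting
-- B saves q|B| while the at most |X||B| edges from X to B add no more than that. Both sides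
-- cannot be free of interior vertices, for then |S| ≤ cost(S) + |X| ≤ 2q² + q. Repeating
-- the deletion ends in a q-connected candidate.

module Submission where

open import Defs
open import Data.Nat using (ℕ; _*_; _<_; _≤_)
open import Data.Fin.Subset using (Subset; ∣_∣)
open import Data.Product using (Σ; _×_)

open import Data.Nat using (_+_; _⊓_; NonZero; >-nonZero; >-nonZero⁻¹; s≤s; z≤n)
open import Data.Nat.Properties
open import Data.Nat.Tactic.RingSolver using (solve-∀)
open import Data.Bool using (true; T; not)
open import Data.Bool.Properties using (T-≡; T-∧; T-not-≡)
open import Data.Fin using (Fin; zero; suc; fromℕ<)
open import Data.Fin.Properties using (any?)
open import Data.Fin.Subset
  using (inside; outside; _∈_; _∉_; _⊆_; _⊂_; _⊃_; _∩_; _∪_; _─_; ⁅_⁆; ⊤; Nonempty)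
open import Data.Fin.Subset.Properties
  using ( _∈?_; _⊆?_; nonempty?; anySubset?; drop-∷-⊆; ⊆-refl; ∈⊤; ⊆⊤; p─⊤≡⊥; ∣⊥∣≡0; Empty-unique
        ; p⊆q⇒∣p∣≤∣q∣; p⊂q⇒∣p∣<∣q∣; x∈⁅x⁆; x∈⁅y⁆⇒x≡y; ∣⁅x⁆∣≡1
        ; x∈p∩q⁺; x∈p∩q⁻; p∩q⊆p; p∩q⊆q; x∈p∪q⁺; x∈p∪q⁻; p⊆p∪q
        ; x∈p∧x∉q⇒x∈p─q; p─q⊆p; p∩q≢∅⇒p─q⊂p; ∣p∩q∣≤∣q∣ )
open import Data.Fin.Subset.Induction using (Acc; acc; ⊂-wellFounded; ⊃-wellFounded)
open import Data.List.Base using (allFin)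
open import Data.List.Relation.Unary.Any using (satisfied)
open import Data.List.Relation.Unary.Any.Properties using (any⁻)
open import Data.Vec using ([]; _∷_; here; there; lookup)
open import Data.Vec.Properties using (lookup∘tabulate; []=⇒lookup; lookup⇒[]=)
open import Data.Product using (∃; _,_; proj₁; proj₂)
open import Data.Sum using (_⊎_; inj₁; inj₂; [_,_]′; map₂)
open import Data.Empty using (⊥-elim)
open import Function using (_∘_; id; Equivalence)
open import Relation.Nullary using (¬_; Dec; yes; no; contradiction)
open import Relation.Nullary.Decidable using (_×-dec_; ¬?; decidable-stable)
open import Relation.Binary.PropositionalEquality as ≡
  using (_≡_; refl; trans; cong; cong₂; subst; module ≡-Reasoning)
open import Algebra.Properties.CommutativeSemigroup +-commutativeSemigroup
  using (interchange; x∙yz≈y∙xz)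

open Equivalence using (to; from)

private
  variable
    n : ℕ

x∈p─q⁻ : ∀ {x : Fin n} (p q : Subset n) → x ∈ p ─ q → x ∈ p × x ∉ q
x∈p─q⁻ p q x∈p─q = p─q⊆p p q x∈p─q , x∉q p q x∈p─q
  where
  x∉q : ∀ {n} {x : Fin n} (p q : Subset n) → x ∈ p ─ q → x ∉ q
  x∉q (_ ∷ p) (inside ∷ q) ()            here
  x∉q (_ ∷ p) (_      ∷ q) (there x∈p─q) (there x∈q) = x∉q p q x∈p─q x∈q

p∪q─p⊆q : ∀ (p q : Subset n) → p ∪ q ─ p ⊆ q
p∪q─p⊆q p q x∈ with x∈p─q⁻ (p ∪ q) p x∈
... | x∈p∪q , x∉p = [ (λ x∈p → contradiction x∈p x∉p) , id ]′ (x∈p∪q⁻ p q x∈p∪q)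

x∈p∪⁅y⁆⁻ : ∀ {x y : Fin n} (p : Subset n) → x ∈ p ∪ ⁅ y ⁆ → x ∈ p ⊎ x ≡ y
x∈p∪⁅y⁆⁻ {y = y} p x∈ = map₂ (x∈⁅y⁆⇒x≡y y) (x∈p∪q⁻ p ⁅ y ⁆ x∈)

x∈p⇒0<∣p∣ : ∀ {x : Fin n} {p : Subset n} → x ∈ p → 0 < ∣ p ∣
x∈p⇒0<∣p∣ {x = x} {p} x∈p = subst (_≤ ∣ p ∣) (∣⁅x⁆∣≡1 x) (p⊆q⇒∣p∣≤∣q∣ ⁅x⁆⊆p)
  where
  ⁅x⁆⊆p : ⁅ x ⁆ ⊆ p
  ⁅x⁆⊆p y∈⁅x⁆ = subst (_∈ p) (≡.sym (x∈⁅y⁆⇒x≡y x y∈⁅x⁆)) x∈p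

T-lookup⇒∈ : ∀ (p : Subset n) x → T (lookup p x) → x ∈ p
T-lookup⇒∈ p x t = lookup⇒[]= x p (to T-≡ t)

T-not-lookup⇒∉ : ∀ (p : Subset n) x → T (not (lookup p x)) → x ∉ p
T-not-lookup⇒∉ p x t x∈p with trans (≡.sym ([]=⇒lookup x∈p)) (to T-not-≡ t)
... | ()

-- Sums over a subset

sumOver : Subset n → (Fin n → ℕ) → ℕ
sumOver []            f = 0
sumOver (inside  ∷ S) f = f zero + sumOver S (f ∘ suc)
sumOver (outside ∷ S) f = sumOver S (f ∘ suc)

syntax sumOver S (λ v → e) = ∑[ v ∈ S ] e

sumOver-const : ∀ (S : Subset n) c → ∑[ v ∈ S ] c ≡ ∣ S ∣ * c
sumOver-const []            c = refl
sumOver-const (inside  ∷ S) c = cong (c +_) (sumOver-const S c)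
sumOver-const (outside ∷ S) c = sumOver-const S c

∣p∣≡∑1 : ∀ (S : Subset n) → ∣ S ∣ ≡ ∑[ v ∈ S ] 1
∣p∣≡∑1 S = ≡.sym (trans (sumOver-const S 1) (*-identityʳ ∣ S ∣))

sumOver-mono-≤ : ∀ (S : Subset n) {f g : Fin n → ℕ} → (∀ {v} → v ∈ S → f v ≤ g v) →
                 sumOver S f ≤ sumOver S g
sumOver-mono-≤ []            f≤g = ≤-refl
sumOver-mono-≤ (inside  ∷ S) f≤g = +-mono-≤ (f≤g here) (sumOver-mono-≤ S (f≤g ∘ there))
sumOver-mono-≤ (outside ∷ S) f≤g = sumOver-mono-≤ S (f≤g ∘ there)

sumOver-mono-⊆ : ∀ {S T : Subset n} (f : Fin n → ℕ) → S ⊆ T → sumOver S f ≤ sumOver T f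
sumOver-mono-⊆ {S = []}          {[]}          f S⊆T = ≤-refl
sumOver-mono-⊆ {S = inside  ∷ S} {inside  ∷ T} f S⊆T =
  +-monoʳ-≤ (f zero) (sumOver-mono-⊆ (f ∘ suc) (drop-∷-⊆ S⊆T))
sumOver-mono-⊆ {S = inside  ∷ S} {outside ∷ T} f S⊆T = contradiction (S⊆T here) λ ()
sumOver-mono-⊆ {S = outside ∷ S} {inside  ∷ T} f S⊆T =
  ≤-trans (sumOver-mono-⊆ (f ∘ suc) (drop-∷-⊆ S⊆T)) (m≤n+m _ (f zero))
sumOver-mono-⊆ {S = outside ∷ S} {outside ∷ T} f S⊆T = sumOver-mono-⊆ (f ∘ suc) (drop-∷-⊆ S⊆T)

sumOver-distrib-+ : ∀ (S : Subset n) (f g : Fin n → ℕ) →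
                    ∑[ v ∈ S ] (f v + g v) ≡ sumOver S f + sumOver S g
sumOver-distrib-+ []            f g = refl
sumOver-distrib-+ (inside  ∷ S) f g =
  trans (cong (f zero + g zero +_) (sumOver-distrib-+ S (f ∘ suc) (g ∘ suc)))
        (interchange (f zero) (g zero) _ _)
sumOver-distrib-+ (outside ∷ S) f g = sumOver-distrib-+ S (f ∘ suc) (g ∘ suc)

sumOver-∩-─ : ∀ (S T : Subset n) (f : Fin n → ℕ) →
              sumOver S f ≡ sumOver (S ∩ T) f + sumOver (S ─ T) f
sumOver-∩-─ []            []            f = refl
sumOver-∩-─ (inside  ∷ S) (inside  ∷ T) f =
  trans (cong (f zero +_) (sumOver-∩-─ S T (f ∘ suc)))
        (≡.sym (+-assoc (f zero) (sumOver (S ∩ T) (f ∘ suc)) _))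
sumOver-∩-─ (inside  ∷ S) (outside ∷ T) f =
  trans (cong (f zero +_) (sumOver-∩-─ S T (f ∘ suc)))
        (x∙yz≈y∙xz (f zero) (sumOver (S ∩ T) (f ∘ suc)) _)
sumOver-∩-─ (outside ∷ S) (inside  ∷ T) f = sumOver-∩-─ S T (f ∘ suc)
sumOver-∩-─ (outside ∷ S) (outside ∷ T) f = sumOver-∩-─ S T (f ∘ suc)

sumOver-∪ : ∀ (S T : Subset n) (f : Fin n → ℕ) → sumOver (S ∪ T) f ≤ sumOver S f + sumOver T f
sumOver-∪ S T f = begin
  sumOver (S ∪ T) f                               ≡⟨ sumOver-∩-─ (S ∪ T) S f ⟩
  sumOver ((S ∪ T) ∩ S) f + sumOver (S ∪ T ─ S) f ≤⟨ +-mono-≤ (sumOver-mono-⊆ f (p∩q⊆q (S ∪ T) S))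
                                                               (sumOver-mono-⊆ f (p∪q─p⊆q S T)) ⟩
  sumOver S f + sumOver T f                       ∎
  where open ≤-Reasoning

sumOver-disjoint : ∀ {S A B : Subset n} (f : Fin n → ℕ) → A ⊆ S → B ⊆ S → (∀ {v} → v ∈ A → v ∉ B) →
                   sumOver A f + sumOver B f ≤ sumOver S f
sumOver-disjoint {S = S} {A} {B} f A⊆S B⊆S A∩B≡∅ = begin
  sumOver A f + sumOver B f             ≤⟨ +-mono-≤ (sumOver-mono-⊆ f A⊆S∩A) (sumOver-mono-⊆ f B⊆S─A) ⟩
  sumOver (S ∩ A) f + sumOver (S ─ A) f ≡⟨ sumOver-∩-─ S A f ⟨
  sumOver S f                           ∎
  where
  open ≤-Reasoning
  A⊆S∩A : A ⊆ S ∩ A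
  A⊆S∩A v∈A = x∈p∩q⁺ (A⊆S v∈A , v∈A)
  B⊆S─A : B ⊆ S ─ A
  B⊆S─A v∈B = x∈p∧x∉q⇒x∈p─q (B⊆S v∈B) (λ v∈A → A∩B≡∅ v∈A v∈B)

sumOver≤∣p∣* : ∀ (S : Subset n) {f : Fin n → ℕ} {c} → (∀ {v} → v ∈ S → f v ≤ c) → sumOver S f ≤ ∣ S ∣ * c
sumOver≤∣p∣* S {c = c} f≤c = ≤-trans (sumOver-mono-≤ S f≤c) (≤-reflexive (sumOver-const S c))

∣p∣≤sumOver : ∀ (S : Subset n) {f : Fin n → ℕ} → (∀ {v} → v ∈ S → 1 ≤ f v) → ∣ S ∣ ≤ sumOver S f
∣p∣≤sumOver S 1≤f = ≤-trans (≤-reflexive (∣p∣≡∑1 S)) (sumOver-mono-≤ S 1≤f)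

∣p∪q∣≤∣p∣+∣q∣ : ∀ (p q : Subset n) → ∣ p ∪ q ∣ ≤ ∣ p ∣ + ∣ q ∣
∣p∪q∣≤∣p∣+∣q∣ p q = begin
  ∣ p ∪ q ∣                   ≡⟨ ∣p∣≡∑1 (p ∪ q) ⟩
  ∑[ v ∈ p ∪ q ] 1            ≤⟨ sumOver-∪ p q _ ⟩
  ∑[ v ∈ p ] 1 + ∑[ v ∈ q ] 1 ≡⟨ cong₂ _+_ (∣p∣≡∑1 p) (∣p∣≡∑1 q) ⟨
  ∣ p ∣ + ∣ q ∣               ∎
  where open ≤-Reasoning

∣p∣≡∣p∩q∣+∣p─q∣ : ∀ (p q : Subset n) → ∣ p ∣ ≡ ∣ p ∩ q ∣ + ∣ p ─ q ∣
∣p∣≡∣p∩q∣+∣p─q∣ p q = begin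
  ∣ p ∣                               ≡⟨ ∣p∣≡∑1 p ⟩
  ∑[ v ∈ p ] 1                        ≡⟨ sumOver-∩-─ p q _ ⟩
  ∑[ v ∈ p ∩ q ] 1 + ∑[ v ∈ p ─ q ] 1 ≡⟨ cong₂ _+_ (∣p∣≡∑1 (p ∩ q)) (∣p∣≡∑1 (p ─ q)) ⟨
  ∣ p ∩ q ∣ + ∣ p ─ q ∣               ∎
  where open ≡-Reasoning

module _ (G : Graph n) where

  adj⇒∈N : ∀ {v w} → adj G v w ≡ true → w ∈ N G v
  adj⇒∈N {v} {w} e = lookup⇒[]= w (N G v) (trans (lookup∘tabulate (adj G v) w) e)

  ∈N⇒adj : ∀ {v w} → w ∈ N G v → adj G v w ≡ true
  ∈N⇒adj {v} {w} w∈Nv = trans (≡.sym (lookup∘tabulate (adj G v) w)) ([]=⇒lookup w∈Nv)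

  ∈N-sym : ∀ {v w} → w ∈ N G v → v ∈ N G w
  ∈N-sym {v} {w} w∈Nv = adj⇒∈N (trans (Graph.sym G w v) (∈N⇒adj w∈Nv))

  v∉N[v] : ∀ v → v ∉ N G v
  v∉N[v] v v∈Nv with trans (≡.sym (irrefl G v)) (∈N⇒adj v∈Nv)
  ... | ()

  Interior : Subset n → Fin n → Set
  Interior S z = z ∈ S × N G z ⊆ S

  interior? : ∀ S z → Dec (Interior S z)
  interior? S z = z ∈? S ×-dec N G z ⊆? S

  ¬interior⇒exposed : ∀ {S z} → z ∈ S → ¬ Interior S z → Nonempty (N G z ─ S)
  ¬interior⇒exposed {S} {z} z∈S ¬interior with nonempty? (N G z ─ S)
  ... | yes exposed = exposed
  ... | no ¬exposed = ⊥-elim (¬interior (z∈S , N⊆S))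
    where
    N⊆S : N G z ⊆ S
    N⊆S {w} w∈N = decidable-stable (w ∈? S) λ w∉S → ¬exposed (w , x∈p∧x∉q⇒x∈p─q w∈N w∉S)

  InteriorFree : Subset n → Subset n → Set
  InteriorFree S P = ∀ {v} → v ∈ P → ¬ Interior S v

  interior-or-free : ∀ S P → (∃ λ v → v ∈ P × Interior S v) ⊎ InteriorFree S P
  interior-or-free S P with any? (λ v → v ∈? P ×-dec interior? S v)
  ... | yes found = inj₁ found
  ... | no ¬found = inj₂ λ v∈P v-interior → ¬found (_ , v∈P , v-interior)

  interior⇒degree<∣S∣ : ∀ {S z} → Interior S z → degree G z < ∣ S ∣
  interior⇒degree<∣S∣ {S} {z} (z∈S , N⊆S) = p⊂q⇒∣p∣<∣q∣ (N⊆S , z , z∈S , v∉N[v] z)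

  boundary⁻ : ∀ {S v} → v ∈ boundary G S → v ∈ S × Nonempty (N G v ─ S)
  boundary⁻ {S} {v} v∈∂S
    with to T-∧ (from T-≡ (trans (≡.sym (lookup∘tabulate _ v)) ([]=⇒lookup v∈∂S)))
  ... | v∈S , has-exit with satisfied (any⁻ _ (allFin n) has-exit)
  ... | w , adj∧∉ with to T-∧ adj∧∉
  ... | adj-vw , w∉S =
    T-lookup⇒∈ S v v∈S , w , x∈p∧x∉q⇒x∈p─q (adj⇒∈N (to T-≡ adj-vw)) (T-not-lookup⇒∉ S w w∉S)

  Closed : Subset n → Subset n → Set
  Closed U C = ∀ {v w} → v ∈ C → w ∈ N G v → w ∈ U → w ∈ C

  reach-closed : ∀ {U C u w} → Closed U C → Reach G U u w → u ∈ C → w ∈ C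
  reach-closed closed (here _)            u∈C = u∈C
  reach-closed closed (step walk adj w∈U) u∈C = closed (reach-closed closed walk u∈C) (adj⇒∈N adj) w∈U

  record Disconnection (U : Subset n) : Set where
    field
      part        : Subset n
      part⊆U      : part ⊆ U
      part-closed : Closed U part
      inner       : Fin n
      inner∈part  : inner ∈ part
      outer       : Fin n
      outer∈U     : outer ∈ U
      outer∉part  : outer ∉ part

  disconnection⇒¬connected : ∀ {U} → Disconnection U → ¬ Connected G U
  disconnection⇒¬connected d connected =
    outer∉part (reach-closed part-closed (connected inner outer (part⊆U inner∈part) outer∈U) inner∈part)
    where open Disconnection d

  module _ (U : Subset n) (u : Fin n) where

    record Component : Set where
      field
        members   : Subset n
        members⊆U : members ⊆ U
        source    : u ∈ U → u ∈ members
        reachable : ∀ {w} → w ∈ members → Reach G U u w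
        closed    : Closed U members

    private
      Explored : Subset n → Set
      Explored C = C ⊆ U × U ∩ ⁅ u ⁆ ⊆ C × (∀ {w} → w ∈ C → Reach G U u w)

      explore : ∀ C → Acc _⊃_ C → Explored C → Component
      explore C (acc larger) (C⊆U , seed⊆C , reach)
        with any? (λ v → any? (λ w → v ∈? C ×-dec w ∈? N G v ×-dec w ∈? U ×-dec ¬? (w ∈? C)))
      ... | yes (v , w , v∈C , w∈Nv , w∈U , w∉C) =
        explore (C ∪ ⁅ w ⁆) (larger (p⊆p∪q ⁅ w ⁆ , w , x∈p∪q⁺ (inj₂ (x∈⁅x⁆ w)) , w∉C))
                (C∪w⊆U , p⊆p∪q ⁅ w ⁆ ∘ seed⊆C , reach′)
        where
        C∪w⊆U : C ∪ ⁅ w ⁆ ⊆ U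
        C∪w⊆U x∈ with x∈p∪⁅y⁆⁻ C x∈
        ... | inj₁ x∈C = C⊆U x∈C
        ... | inj₂ refl = w∈U
        reach′ : ∀ {x} → x ∈ C ∪ ⁅ w ⁆ → Reach G U u x
        reach′ x∈ with x∈p∪⁅y⁆⁻ C x∈
        ... | inj₁ x∈C = reach x∈C
        ... | inj₂ refl = step (reach v∈C) (∈N⇒adj w∈Nv) w∈U
      ... | no no-exit = record
        { members   = C
        ; members⊆U = C⊆U
        ; source    = λ u∈U → seed⊆C (x∈p∩q⁺ (u∈U , x∈⁅x⁆ u))
        ; reachable = reach
        ; closed    = λ {v} {w} v∈C w∈Nv w∈U →
            decidable-stable (w ∈? C) λ w∉C → no-exit (v , w , v∈C , w∈Nv , w∈U , w∉C)
        }

      seed-reachable : ∀ {w} → w ∈ U ∩ ⁅ u ⁆ → Reach G U u w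
      seed-reachable w∈ with x∈p∩q⁻ U ⁅ u ⁆ w∈
      ... | w∈U , w∈⁅u⁆ with x∈⁅y⁆⇒x≡y u w∈⁅u⁆
      ...   | refl = here w∈U

    -- Seeding with U ∩ ⁅ u ⁆ rather than ⁅ u ⁆ keeps the construction total: for u ∉ U it is ∅.
    component : Component
    component = explore (U ∩ ⁅ u ⁆) (⊃-wellFounded _) (p∩q⊆p U ⁅ u ⁆ , ⊆-refl , seed-reachable)

  connected-or-disconnected : ∀ U → Connected G U ⊎ Disconnection U
  connected-or-disconnected U
    with any? (λ u → any? (λ v → u ∈? U ×-dec v ∈? U ×-dec ¬? (v ∈? Component.members (component U u))))
  ... | yes (u , v , u∈U , v∈U , v∉C) = inj₂ record
    { part        = members
    ; part⊆U      = members⊆U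
    ; part-closed = closed
    ; inner       = u
    ; inner∈part  = source u∈U
    ; outer       = v
    ; outer∈U     = v∈U
    ; outer∉part  = v∉C
    }
    where open Component (component U u)
  ... | no ¬split = inj₁ λ u v u∈U v∈U →
    Component.reachable (component U u)
      (decidable-stable (_ ∈? _) λ v∉C → ¬split (u , v , u∈U , v∈U , v∉C))

  disconnection? : ∀ U → Dec (Disconnection U)
  disconnection? U with connected-or-disconnected U
  ... | inj₁ connected = no λ d → disconnection⇒¬connected d connected
  ... | inj₂ d         = yes d

  Cut : ℕ → Subset n → Set
  Cut k S = ∃ λ X → X ⊆ S × ∣ X ∣ < k × Disconnection (S ─ X)

  kconnected-or-cut : ∀ k S → k < ∣ S ∣ → KConnected G k S ⊎ Cut k S
  kconnected-or-cut k S k<∣S∣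
    with anySubset? (λ X → X ⊆? S ×-dec ∣ X ∣ <? k ×-dec disconnection? (S ─ X))
  ... | yes cut = inj₂ cut
  ... | no ¬cut = inj₁ (k<∣S∣ , connected)
    where
    connected : ∀ X → X ⊆ S → ∣ X ∣ < k → Connected G (S ─ X)
    connected X X⊆S ∣X∣<k with connected-or-disconnected (S ─ X)
    ... | inj₁ S─X-connected = S─X-connected
    ... | inj₂ d             = ⊥-elim (¬cut (X , X⊆S , ∣X∣<k , d))

  record Separation (k : ℕ) (S : Subset n) : Set where
    field
      A B X      : Subset n
      A⊆S        : A ⊆ S
      B⊆S        : B ⊆ S
      covers     : ∀ {v} → v ∈ S → v ∈ A ⊎ v ∈ B ⊎ v ∈ X
      disjoint   : ∀ {v} → v ∈ A → v ∉ B
      no-edge    : ∀ {a b} → a ∈ A → b ∈ N G a → b ∉ B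
      ∣X∣≤k      : ∣ X ∣ ≤ k
      A-nonempty : Nonempty A
      B-nonempty : Nonempty B

  swap : ∀ {k S} → Separation k S → Separation k S
  swap σ = record
    { A          = B
    ; B          = A
    ; X          = X
    ; A⊆S        = B⊆S
    ; B⊆S        = A⊆S
    ; covers     = [ inj₂ ∘ inj₁ , [ inj₁ , inj₂ ∘ inj₂ ]′ ]′ ∘ covers
    ; disjoint   = λ v∈B v∈A → disjoint v∈A v∈B
    ; no-edge    = λ b∈B a∈Nb a∈A → no-edge a∈A (∈N-sym a∈Nb) b∈B
    ; ∣X∣≤k      = ∣X∣≤k
    ; A-nonempty = B-nonempty
    ; B-nonempty = A-nonempty
    }
    where open Separation σ

  cut⇒separation : ∀ {k S} → Cut k S → Separation k S
  cut⇒separation {k} {S} (X , X⊆S , ∣X∣<k , d) = record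
    { A          = part
    ; B          = S ─ X ─ part
    ; X          = X
    ; A⊆S        = p─q⊆p S X ∘ part⊆U
    ; B⊆S        = p─q⊆p S X ∘ p─q⊆p (S ─ X) part
    ; covers     = covers
    ; disjoint   = λ v∈A v∈B → proj₂ (x∈p─q⁻ (S ─ X) part v∈B) v∈A
    ; no-edge    = no-edge
    ; ∣X∣≤k      = <⇒≤ ∣X∣<k
    ; A-nonempty = inner , inner∈part
    ; B-nonempty = outer , x∈p∧x∉q⇒x∈p─q outer∈U outer∉part
    }
    where
    open Disconnection d
    covers : ∀ {v} → v ∈ S → v ∈ part ⊎ v ∈ S ─ X ─ part ⊎ v ∈ X
    covers {v} v∈S with v ∈? X | v ∈? part
    ... | yes v∈X | _        = inj₂ (inj₂ v∈X)
    ... | no _    | yes v∈A  = inj₁ v∈A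
    ... | no v∉X  | no v∉A   = inj₂ (inj₁ (x∈p∧x∉q⇒x∈p─q (x∈p∧x∉q⇒x∈p─q v∈S v∉X) v∉A))
    no-edge : ∀ {a b} → a ∈ part → b ∈ N G a → b ∉ S ─ X ─ part
    no-edge a∈A b∈Na b∈B with x∈p─q⁻ (S ─ X) part b∈B
    ... | b∈S─X , b∉A = b∉A (part-closed a∈A b∈Na b∈S─X)

module _ {G : Graph n} {k : ℕ} {S : Subset n} (σ : Separation G k S) where
  open Separation σ

  kept⊂S : S ─ B ⊂ S
  kept⊂S with B-nonempty
  ... | b , b∈B = p∩q≢∅⇒p─q⊂p S B (b , x∈p∩q⁺ (B⊆S b∈B , b∈B))

  kept⊆A∪X : S ─ B ⊆ A ∪ X
  kept⊆A∪X v∈K with x∈p─q⁻ S B v∈K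
  ... | v∈S , v∉B = [ x∈p∪q⁺ ∘ inj₁ , [ (λ v∈B → contradiction v∈B v∉B) , x∈p∪q⁺ ∘ inj₂ ]′ ]′ (covers v∈S)

  S⊆A∪B∪X : S ⊆ (A ∪ B) ∪ X
  S⊆A∪B∪X v∈S =
    [ x∈p∪q⁺ ∘ inj₁ ∘ x∈p∪q⁺ ∘ inj₁ , [ x∈p∪q⁺ ∘ inj₁ ∘ x∈p∪q⁺ ∘ inj₂ , x∈p∪q⁺ ∘ inj₂ ]′ ]′ (covers v∈S)

  N∩S⊆B∪X : ∀ {b} → b ∈ B → N G b ∩ S ⊆ B ∪ X
  N∩S⊆B∪X b∈B v∈ with x∈p∩q⁻ _ S v∈
  ... | v∈Nb , v∈S =
    [ (λ v∈A → contradiction b∈B (no-edge v∈A (∈N-sym G v∈Nb))) , x∈p∪q⁺ ]′ (covers v∈S)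

  ∣N∩B∣≡0 : ∀ {a} → a ∈ A → ∣ N G a ∩ B ∣ ≡ 0
  ∣N∩B∣≡0 {a} a∈A = trans (cong ∣_∣ (Empty-unique no-common)) (∣⊥∣≡0 n)
    where
    no-common : ¬ Nonempty (N G a ∩ B)
    no-common (b , b∈) with x∈p∩q⁻ (N G a) B b∈
    ... | b∈Na , b∈B = no-edge a∈A b∈Na b∈B

  interior-kept : ∀ {a} → a ∈ A → Interior G S a → Interior G (S ─ B) a
  interior-kept a∈A (a∈S , N⊆S) =
    x∈p∧x∉q⇒x∈p─q a∈S (disjoint a∈A) , λ w∈N → x∈p∧x∉q⇒x∈p─q (N⊆S w∈N) (no-edge a∈A w∈N)

-- The cost of a vertex set

module _ (G : Graph n) (q : ℕ) where

  weight : Subset n → Fin n → ℕ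
  weight S v = q ⊓ ∣ N G v ─ S ∣

  cost : Subset n → ℕ
  cost S = ∑[ v ∈ S ] weight S v

  cost-⊤ : cost ⊤ ≡ 0
  cost-⊤ = n≤0⇒n≡0 (begin
    cost ⊤          ≤⟨ sumOver≤∣p∣* ⊤ (λ {v} _ → weight-⊤ v) ⟩
    ∣ ⊤ {n} ∣ * 0   ≡⟨ *-zeroʳ ∣ ⊤ {n} ∣ ⟩
    0               ∎)
    where
    open ≤-Reasoning
    weight-⊤ : ∀ v → weight ⊤ v ≤ 0
    weight-⊤ v = ≤-trans (m⊓n≤n q _) (≤-reflexive (trans (cong ∣_∣ (p─⊤≡⊥ (N G v))) (∣⊥∣≡0 n)))

  weight-─ : ∀ S B v → weight (S ─ B) v ≤ weight S v + ∣ N G v ∩ B ∣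
  weight-─ S B v = begin
    q ⊓ ∣ N G v ─ (S ─ B) ∣                 ≤⟨ ⊓-monoʳ-≤ q (p⊆q⇒∣p∣≤∣q∣ exits) ⟩
    q ⊓ ∣ (N G v ─ S) ∪ (N G v ∩ B) ∣       ≤⟨ ⊓-monoʳ-≤ q (∣p∪q∣≤∣p∣+∣q∣ (N G v ─ S) (N G v ∩ B)) ⟩
    q ⊓ (∣ N G v ─ S ∣ + ∣ N G v ∩ B ∣)     ≤⟨ ⊓-monoˡ-≤ _ (m≤m+n q _) ⟩
    (q + e) ⊓ (∣ N G v ─ S ∣ + e)           ≡⟨ +-distribʳ-⊓ e q ∣ N G v ─ S ∣ ⟨
    q ⊓ ∣ N G v ─ S ∣ + e                   ∎
    where
    open ≤-Reasoning
    e = ∣ N G v ∩ B ∣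
    exits : N G v ─ (S ─ B) ⊆ (N G v ─ S) ∪ (N G v ∩ B)
    exits {w} w∈ with x∈p─q⁻ (N G v) (S ─ B) w∈ | w ∈? S | w ∈? B
    ... | w∈N , _      | no w∉S  | _       = x∈p∪q⁺ (inj₁ (x∈p∧x∉q⇒x∈p─q w∈N w∉S))
    ... | w∈N , _      | yes _   | yes w∈B = x∈p∪q⁺ (inj₂ (x∈p∩q⁺ (w∈N , w∈B)))
    ... | _   , w∉S─B  | yes w∈S | no w∉B  = contradiction (x∈p∧x∉q⇒x∈p─q w∈S w∉B) w∉S─B

  ∣exposed∣≤∑weight : .{{NonZero q}} → ∀ {S P} → (∀ {v} → v ∈ P → Nonempty (N G v ─ S)) →
                     ∣ P ∣ ≤ ∑[ v ∈ P ] weight S v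
  ∣exposed∣≤∑weight {P = P} exposed = ∣p∣≤sumOver P λ v∈P →
    ⊓-glb (>-nonZero⁻¹ q) (x∈p⇒0<∣p∣ (proj₂ (exposed v∈P)))

  ∣non-interior∣≤∑weight : .{{NonZero q}} → ∀ {S P} → P ⊆ S → InteriorFree G S P →
                          ∣ P ∣ ≤ ∑[ v ∈ P ] weight S v
  ∣non-interior∣≤∑weight P⊆S ¬interior =
    ∣exposed∣≤∑weight (λ v∈P → ¬interior⇒exposed G (P⊆S v∈P) (¬interior v∈P))

  ∣boundary∣≤cost : .{{NonZero q}} → ∀ S → ∣ boundary G S ∣ ≤ cost S
  ∣boundary∣≤cost S = ≤-trans (∣exposed∣≤∑weight (proj₂ ∘ boundary⁻ G))
                              (sumOver-mono-⊆ (weight S) (proj₁ ∘ boundary⁻ G {S}))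

  module _ {S : Subset n} (σ : Separation G q S) where
    open Separation σ

    cost-kept≤∑A+∣X∣*q : cost (S ─ B) ≤ ∑[ v ∈ A ] weight S v + ∣ X ∣ * q
    cost-kept≤∑A+∣X∣*q = begin
      cost (S ─ B)                                       ≤⟨ sumOver-mono-⊆ (weight (S ─ B)) (kept⊆A∪X σ) ⟩
      ∑[ v ∈ A ∪ X ] weight (S ─ B) v                    ≤⟨ sumOver-∪ A X _ ⟩
      ∑[ v ∈ A ] weight (S ─ B) v + ∑[ v ∈ X ] weight (S ─ B) v
        ≤⟨ +-mono-≤ (sumOver-mono-≤ A weight-kept) (sumOver≤∣p∣* X (λ _ → m⊓n≤m q _)) ⟩
      ∑[ v ∈ A ] weight S v + ∣ X ∣ * q                 ∎
      where
      open ≤-Reasoning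
      weight-kept : ∀ {a} → a ∈ A → weight (S ─ B) a ≤ weight S a
      weight-kept {a} a∈A = ≤-trans (weight-─ S B a)
        (≤-reflexive (trans (cong (weight S a +_) (∣N∩B∣≡0 σ a∈A)) (+-identityʳ _)))

    edges-into-B≤∣X∣*∣B∣ : ∑[ v ∈ S ─ B ] ∣ N G v ∩ B ∣ ≤ ∣ X ∣ * ∣ B ∣
    edges-into-B≤∣X∣*∣B∣ = begin
      ∑[ v ∈ S ─ B ] ∣ N G v ∩ B ∣                          ≤⟨ sumOver-mono-⊆ _ (kept⊆A∪X σ) ⟩
      ∑[ v ∈ A ∪ X ] ∣ N G v ∩ B ∣                          ≤⟨ sumOver-∪ A X _ ⟩
      ∑[ v ∈ A ] ∣ N G v ∩ B ∣ + ∑[ v ∈ X ] ∣ N G v ∩ B ∣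
        ≤⟨ +-mono-≤ (sumOver≤∣p∣* A (≤-reflexive ∘ ∣N∩B∣≡0 σ)) (sumOver≤∣p∣* X (λ {v} _ → ∣p∩q∣≤∣q∣ (N G v) B)) ⟩
      ∣ A ∣ * 0 + ∣ X ∣ * ∣ B ∣                              ≡⟨ cong (_+ ∣ X ∣ * ∣ B ∣) (*-zeroʳ ∣ A ∣) ⟩
      ∣ X ∣ * ∣ B ∣                                          ∎
      where open ≤-Reasoning

    cost-kept≤cost : (∀ {b} → b ∈ B → q ≤ ∣ N G b ─ S ∣) → cost (S ─ B) ≤ cost S
    cost-kept≤cost saturated = begin
      cost (S ─ B)                                           ≤⟨ sumOver-mono-≤ (S ─ B) (λ {v} _ → weight-─ S B v) ⟩
      ∑[ v ∈ S ─ B ] (weight S v + ∣ N G v ∩ B ∣)             ≡⟨ sumOver-distrib-+ (S ─ B) (weight S) _ ⟩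
      ∑[ v ∈ S ─ B ] weight S v + ∑[ v ∈ S ─ B ] ∣ N G v ∩ B ∣ ≤⟨ +-monoʳ-≤ _ (≤-trans edges-into-B≤∣X∣*∣B∣ ∣X∣*∣B∣≤∑B) ⟩
      ∑[ v ∈ S ─ B ] weight S v + ∑[ v ∈ B ] weight S v     ≤⟨ sumOver-disjoint (weight S) (p─q⊆p S B) B⊆S
                                                                   (proj₂ ∘ x∈p─q⁻ S B) ⟩
      cost S                                                 ∎
      where
      open ≤-Reasoning
      ∣X∣*∣B∣≤∑B : ∣ X ∣ * ∣ B ∣ ≤ ∑[ v ∈ B ] weight S v
      ∣X∣*∣B∣≤∑B = begin
        ∣ X ∣ * ∣ B ∣          ≤⟨ *-monoˡ-≤ ∣ B ∣ ∣X∣≤k ⟩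
        q * ∣ B ∣              ≡⟨ *-comm q ∣ B ∣ ⟩
        ∣ B ∣ * q              ≡⟨ sumOver-const B q ⟨
        ∑[ v ∈ B ] q           ≤⟨ sumOver-mono-≤ B (λ b∈B → ⊓-glb ≤-refl (saturated b∈B)) ⟩
        ∑[ v ∈ B ] weight S v  ∎

≤-half : ∀ {a b c} → a ≤ b → a + b ≤ c + c → a ≤ c
≤-half {a} {b} {c} a≤b a+b≤c+c with a ≤? c
... | yes a≤c = a≤c
... | no  a≰c = contradiction (≤-trans (+-monoʳ-≤ a a≤b) a+b≤c+c) (<⇒≱ (+-mono-< (≰⇒> a≰c) (≰⇒> a≰c)))

2*m*m≡m*m+m*m : ∀ m → 2 * m * m ≡ m * m + m * m
2*m*m≡m*m+m*m = solve-∀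

4*m*m≡2*m*m+2*m*m : ∀ m → 4 * m * m ≡ 2 * m * m + 2 * m * m
4*m*m≡2*m*m+2*m*m = solve-∀

module _ (G : Graph n) (q : ℕ) .{{_ : NonZero q}} (δ≥4q² : MinDegree≥ G (4 * q * q)) where

  private
    q+q≤2q² : q + q ≤ 2 * q * q
    q+q≤2q² = ≤-trans (+-mono-≤ (m≤m*n q q) (m≤m*n q q)) (≤-reflexive (≡.sym (2*m*m≡m*m+m*m q)))

    2q²+q≤4q² : 2 * q * q + q ≤ 4 * q * q
    2q²+q≤4q² = begin
      2 * q * q + q         ≤⟨ +-monoʳ-≤ (2 * q * q) (≤-trans (m≤m+n q q) q+q≤2q²) ⟩
      2 * q * q + 2 * q * q ≡⟨ 4*m*m≡2*m*m+2*m*m q ⟨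
      4 * q * q             ∎
      where open ≤-Reasoning

    q≤4q² : q ≤ 4 * q * q
    q≤4q² = ≤-trans (m≤n+m q (2 * q * q)) 2q²+q≤4q²

    4q²≤2q²+q+o⇒q≤o : ∀ {o} → 4 * q * q ≤ 2 * q * q + q + o → q ≤ o
    4q²≤2q²+q+o⇒q≤o {o} 4q²≤ = +-cancelˡ-≤ q q o (+-cancelˡ-≤ (2 * q * q) (q + q) (q + o) (begin
      2 * q * q + (q + q)   ≤⟨ +-monoʳ-≤ (2 * q * q) q+q≤2q² ⟩
      2 * q * q + 2 * q * q ≡⟨ 4*m*m≡2*m*m+2*m*m q ⟨
      4 * q * q             ≤⟨ 4q²≤ ⟩
      2 * q * q + q + o     ≡⟨ +-assoc (2 * q * q) q o ⟩
      2 * q * q + (q + o)   ∎))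
      where open ≤-Reasoning

  Candidate : Subset n → Set
  Candidate S = cost G q S ≤ 2 * q * q × ∃ (Interior G S)

  candidate-large : ∀ {S} → Candidate S → 4 * q * q < ∣ S ∣
  candidate-large (_ , z , z-interior) = ≤-<-trans (δ≥4q² z) (interior⇒degree<∣S∣ G z-interior)

  SmallerCandidate : Subset n → Set
  SmallerCandidate S = ∃ λ K → K ⊂ S × Candidate K

  module _ {S : Subset n} (σ : Separation G q S) where
    open Separation σ

    keep-A-side : ∀ {a} → a ∈ A → Interior G S a → cost G q (S ─ B) ≤ 2 * q * q → SmallerCandidate S
    keep-A-side a∈A a-interior cost≤ = S ─ B , kept⊂S σ , cost≤ , _ , interior-kept σ a∈A a-interior

    keep-lighter-side : Candidate S → ∀ {a} → a ∈ A → Interior G S a →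
                        ∑[ v ∈ A ] weight G q S v ≤ ∑[ v ∈ B ] weight G q S v → SmallerCandidate S
    keep-lighter-side (cost≤ , _) a∈A a-interior A≤B = keep-A-side a∈A a-interior (begin
      cost G q (S ─ B)                      ≤⟨ cost-kept≤∑A+∣X∣*q G q σ ⟩
      ∑[ v ∈ A ] weight G q S v + ∣ X ∣ * q ≤⟨ +-mono-≤ A≤q² (*-monoˡ-≤ q ∣X∣≤k) ⟩
      q * q + q * q                         ≡⟨ 2*m*m≡m*m+m*m q ⟨
      2 * q * q                             ∎)
      where
      open ≤-Reasoning
      A≤q² : ∑[ v ∈ A ] weight G q S v ≤ q * q
      A≤q² = ≤-half A≤B (begin
        ∑[ v ∈ A ] weight G q S v + ∑[ v ∈ B ] weight G q S v ≤⟨ sumOver-disjoint _ A⊆S B⊆S disjoint ⟩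
        cost G q S                                            ≤⟨ cost≤ ⟩
        2 * q * q                                             ≡⟨ 2*m*m≡m*m+m*m q ⟩
        q * q + q * q                                         ∎)

    saturated : cost G q S ≤ 2 * q * q → InteriorFree G S B → ∀ {b} → b ∈ B → q ≤ ∣ N G b ─ S ∣
    saturated cost≤ ¬interior {b} b∈B = 4q²≤2q²+q+o⇒q≤o (begin
      4 * q * q                          ≤⟨ δ≥4q² b ⟩
      ∣ N G b ∣                          ≡⟨ ∣p∣≡∣p∩q∣+∣p─q∣ (N G b) S ⟩
      ∣ N G b ∩ S ∣ + ∣ N G b ─ S ∣      ≤⟨ +-monoˡ-≤ _ inside-neighbours ⟩
      2 * q * q + q + ∣ N G b ─ S ∣      ∎)
      where
      open ≤-Reasoning
      ∣B∣≤2q² : ∣ B ∣ ≤ 2 * q * q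
      ∣B∣≤2q² = ≤-trans (∣non-interior∣≤∑weight G q B⊆S ¬interior) (≤-trans (sumOver-mono-⊆ _ B⊆S) cost≤)
      inside-neighbours : ∣ N G b ∩ S ∣ ≤ 2 * q * q + q
      inside-neighbours = begin
        ∣ N G b ∩ S ∣   ≤⟨ p⊆q⇒∣p∣≤∣q∣ (N∩S⊆B∪X σ b∈B) ⟩
        ∣ B ∪ X ∣       ≤⟨ ∣p∪q∣≤∣p∣+∣q∣ B X ⟩
        ∣ B ∣ + ∣ X ∣   ≤⟨ +-mono-≤ ∣B∣≤2q² ∣X∣≤k ⟩
        2 * q * q + q   ∎

    drop-interior-free-side : Candidate S → ∀ {a} → a ∈ A → Interior G S a → InteriorFree G S B →
                              SmallerCandidate S
    drop-interior-free-side (cost≤ , _) a∈A a-interior ¬interior =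
      keep-A-side a∈A a-interior (≤-trans (cost-kept≤cost G q σ (saturated cost≤ ¬interior)) cost≤)

    ∣S∣≤cost+q : InteriorFree G S A → InteriorFree G S B → ∣ S ∣ ≤ cost G q S + q
    ∣S∣≤cost+q ¬interiorA ¬interiorB = begin
      ∣ S ∣                      ≤⟨ p⊆q⇒∣p∣≤∣q∣ (S⊆A∪B∪X σ) ⟩
      ∣ (A ∪ B) ∪ X ∣            ≤⟨ ∣p∪q∣≤∣p∣+∣q∣ (A ∪ B) X ⟩
      ∣ A ∪ B ∣ + ∣ X ∣          ≤⟨ +-mono-≤ (∣p∪q∣≤∣p∣+∣q∣ A B) ∣X∣≤k ⟩
      ∣ A ∣ + ∣ B ∣ + q          ≤⟨ +-monoˡ-≤ q
                                      (+-mono-≤ (∣non-interior∣≤∑weight G q A⊆S ¬interiorA)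
                                                (∣non-interior∣≤∑weight G q B⊆S ¬interiorB)) ⟩
      ∑[ v ∈ A ] weight G q S v + ∑[ v ∈ B ] weight G q S v + q
        ≤⟨ +-monoˡ-≤ q (sumOver-disjoint _ A⊆S B⊆S disjoint) ⟩
      cost G q S + q             ∎
      where open ≤-Reasoning

  shrink : ∀ {S} → Candidate S → Separation G q S → SmallerCandidate S
  shrink {S} cand@(cost≤ , _) σ
    with interior-or-free G S (Separation.A σ) | interior-or-free G S (Separation.B σ)
  ... | inj₁ (_ , a∈A , a-interior) | inj₁ (_ , b∈B , b-interior) =
    [ keep-lighter-side σ cand a∈A a-interior , keep-lighter-side (swap G σ) cand b∈B b-interior ]′ (≤-total _ _)
  ... | inj₁ (_ , a∈A , a-interior) | inj₂ B-free = drop-interior-free-side σ cand a∈A a-interior B-free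
  ... | inj₂ A-free | inj₁ (_ , b∈B , b-interior) = drop-interior-free-side (swap G σ) cand b∈B b-interior A-free
  ... | inj₂ A-free | inj₂ B-free = contradiction
    (≤-trans (∣S∣≤cost+q σ A-free B-free) (≤-trans (+-monoˡ-≤ q cost≤) 2q²+q≤4q²))
    (<⇒≱ (candidate-large cand))

  Piece : Subset n → Set
  Piece S = KConnected G q S × 4 * q * q < ∣ S ∣ × ∣ boundary G S ∣ ≤ 2 * q * q

  refine : ∀ S → Acc _⊂_ S → Candidate S → Σ (Subset n) Piece
  refine S (acc smaller) cand@(cost≤ , _)
    with kconnected-or-cut G q S (≤-<-trans q≤4q² (candidate-large cand))
  ... | inj₁ kconnected = S , kconnected , candidate-large cand , ≤-trans (∣boundary∣≤cost G q S) cost≤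
  ... | inj₂ cut with shrink cand (cut⇒separation G cut)
  ...   | K , K⊂S , K-candidate = refine K (smaller K⊂S) K-candidate

  ⊤-candidate : Fin n → Candidate ⊤
  ⊤-candidate z = ≤-trans (≤-reflexive (cost-⊤ G q)) z≤n , z , ∈⊤ , ⊆⊤

corollary2p10 : (q : ℕ) → 2 ≤ q → (n : ℕ) → (G : Graph n) → 0 < n →
    MinDegree≥ G (4 * q * q) →
    Σ (Subset n) (λ S → KConnected G q S × 4 * q * q < ∣ S ∣ ×
      ∣ boundary G S ∣ ≤ 2 * q * q)
corollary2p10 q q≥2 n G n>0 δ≥4q² =
  refine G q δ≥4q² ⊤ (⊂-wellFounded ⊤) (⊤-candidate G q δ≥4q² (fromℕ< n>0))
  where
  instance
    q-nonZero : NonZero q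
    q-nonZero = >-nonZero (≤-trans (s≤s z≤n) q≥2)
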